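{- Let $n>1$ be an integer. For each $i\in\{0,1,\dots,n\}$ let $ST_n^i$ be the subdigraph of $\vec{ST}_{n+1}$ induced by the vertices whose $0$th or $1$st entry equals $i$. Then these $n+1$ subdigraphs $ST_n^i$ ($0\le i\le n$) are copies of the star graph $ST_n$ with their arcs oriented from the vertices with $0$th entry equal to $i$ to the vertices with $1$st entry equal to $i$, and for each $i$ the set of neighbors of $ST_n^i$ (the vertices outside $ST_n^i$ joined by an arc to a vertex of $ST_n^i$) is the disjoint union of the vertex sets of the $n-1$ copies $\zeta_n^{i,j}(\vec{ST}_n)$ of $\vec{ST}_n$, $2\le j\le n$, each counted once.
   Context: For $m\ge 1$, an even permutation $\sigma$ of $\{0,\dots,m-1\}$ is written as the tuple $x_0\dots x_{m-1}$ with $x_k=\sigma(k)$ (its $k$th entry). The star graph $ST_m$ is the (undirected) Cayley graph of $\mathrm{Sym}_m$ with respect to the transpositions $(0\,i)$, $1\le i\le m-1$. The star digraph $\vec{ST}_m$ has vertex set $\mathrm{Alt}_m$ and, for each $i\in\{2,\dots,m-1\}$, an arc from $x_0x_1\dots x_{m-1}$ to $y_0y_1\dots y_{m-1}$ where $y_0=x_i$, $y_1=x_0$, $y_i=x_1$, $y_k=x_k$ otherwise. For $0\le i\le n$ and $x\in\{0,\dots,n-1\}$ let $x^i=x$ if $x<i$ and $x^i=x+1$ if $x\ge i$; for $2\le j\le n$ define $\zeta_n^{i,j}(x_0x_1\dots x_{n-1})=\psi^{i,j}(x_0^i,x_1^i)\,x_2^i\dots x_{j-1}^i\; i\; x_j^i\dots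 x_{n-1}^i$ (symbol $i$ inserted at position $j$), where $\psi^{i,j}(x,y)=xy$ if $n-i+j$ is even and $yx$ otherwise; $\zeta_n^{i,j}(\vec{ST}_n)$ denotes the induced subdigraph of $\vec{ST}_{n+1}$ on its image. -}

module Defs where

open import Data.Nat using (ℕ; zero; suc; _+_; _∸_; _%_)
open import Data.Fin using (Fin; toℕ; punchIn; _<?_)
open import Data.Vec using (Vec; []; _∷_; lookup; map; insertAt; _[_]≔_)
open import Data.Bool using (Bool; true; false; if_then_else_)
open import Data.Product using (Σ; _×_)
open import Data.Sum using (_⊎_)
open import Data.Empty using (⊥)
open import Relation.Nullary using (¬_; yes; no)
open import Relation.Binary.PropositionalEquality using (_≡_)

Tuple : ℕ → Set
Tuple m = Vec (Fin m) m

-- x is (the tuple of) a permutation of {0,…,m-1}: injective on a finite set.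
IsPerm : ∀ {m} → Tuple m → Set
IsPerm {m} x = (p q : Fin m) → lookup x p ≡ lookup x q → p ≡ q

countBelow : ∀ {m k} → Fin m → Vec (Fin m) k → ℕ
countBelow a [] = 0
countBelow a (b ∷ r) with b <? a
... | yes _ = suc (countBelow a r)
... | no  _ = countBelow a r

inversions : ∀ {m k} → Vec (Fin m) k → ℕ
inversions [] = 0
inversions (a ∷ r) = countBelow a r + inversions r

IsEven : ℕ → Set
IsEven k = k % 2 ≡ 0

-- even permutation: vertex of the star digraph (element of Alt_m)
IsAlt : ∀ {m} → Tuple m → Set
IsAlt x = IsPerm x × IsEven (inversions x)

-- Star graph ST_m: σ adjacent to σ∘(0 k), i.e. swap entries at positions 0 and k (1 ≤ k ≤ m-1).
-- Here position k = 1 + k' with k' : Fin (m-1).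
STAdj : ∀ {m} → Tuple m → Tuple m → Set
STAdj [] y = ⊥
STAdj (a ∷ r) y = Σ (Fin _) λ k → y ≡ (lookup r k ∷ (r [ k ]≔ a))

-- Star digraph arc x → y for position i = 2 + k (2 ≤ i ≤ m-1):
-- y₀ = x_i, y₁ = x₀, y_i = x₁, y_l = x_l otherwise.
Arc : ∀ {m} → Tuple m → Tuple m → Set
Arc (a ∷ b ∷ r) y = Σ (Fin _) λ k → y ≡ (lookup r k ∷ a ∷ (r [ k ]≔ b))
Arc _ y = ⊥

Entry0≡ : ∀ {m} → Fin m → Tuple m → Set
Entry0≡ i (a ∷ r) = a ≡ i
Entry0≡ i [] = ⊥

Entry1≡ : ∀ {m} → Fin m → Tuple m → Set
Entry1≡ i (a ∷ b ∷ r) = b ≡ i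
Entry1≡ i _ = ⊥

InSTi : ∀ {n} → Fin (suc n) → Tuple (suc n) → Set
InSTi i v = IsAlt v × (Entry0≡ i v ⊎ Entry1≡ i v)

NeighbourOf : ∀ {n} → Fin (suc n) → Tuple (suc n) → Set
NeighbourOf {n} i v = IsAlt v × ¬ InSTi i v
  × Σ (Tuple (suc n)) λ w → InSTi i w × (Arc v w ⊎ Arc w v)

isEvenᵇ : ℕ → Bool
isEvenᵇ zero = true
isEvenᵇ (suc zero) = false
isEvenᵇ (suc (suc k)) = isEvenᵇ k

swap01 : ∀ {A : Set} {m} → Vec A m → Vec A m
swap01 (a ∷ b ∷ r) = b ∷ a ∷ r
swap01 v = v

ζ : (n : ℕ) → Fin (suc n) → Fin (suc n) → Tuple n → Tuple (suc n)
ζ n i j x =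
  if isEvenᵇ (toℕ i + toℕ j) then w else swap01 w
  where w = insertAt (map (punchIn i) x) j i

-- Prepending i to σ (with σ's symbols shifted around i by punchIn) and, when the result is odd,
-- swapping its first two entries identifies Sym_n with ST_n^i.  A star transposition of σ flips the
-- parity of this tuple, so of two adjacent σ, τ one image starts with i and the other has i second,
-- and the arc between them runs in that direction.  A vertex outside ST_n^i is joined to it exactly
-- when i sits at a position j ≥ 2; deleting that i after undoing ψ gives the unique even x with
-- ζ_n^{i,j}(x) = v, and the position of i determines j.  Parities are tracked by inversion counts:
-- a transposition of distinct entries flips the parity, and inserting i at position j into the
-- shifted x adds i + j inversions modulo 2, which ψ cancels.

module Submission where

open import Defs
open import Data.Nat using (ℕ; zero; suc; _+_; _<_; _≤_; z≤n; s≤s; parity)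
open import Data.Nat.Properties using (<-cmp; <-asym; <⇒≢; <⇒≤; n<1+n; +-comm; +-commutativeSemigroup)
open import Algebra.Properties.CommutativeSemigroup +-commutativeSemigroup using (x∙yz≈y∙xz; interchange)
open import Data.Parity.Base using (Parity; 0ℙ; 1ℙ; _⁻¹) renaming (_+_ to _⊕_)
open import Data.Parity.Properties as ℙ using (⁻¹-involutive; p+p≡0ℙ; +-homo-+)
open import Algebra.Properties.CommutativeSemigroup ℙ.+-commutativeSemigroup using () renaming (xy∙z≈xz∙y to ⊕-xy∙z≈xz∙y)
open import Data.Fin as F using (Fin; toℕ; punchIn; punchOut; zero; suc; _<?_)
open import Data.Fin.Properties using (_≟_; toℕ-injective; suc-injective; punchIn-injective; punchInᵢ≢i; punchIn-punchOut; punchOut-injective; pigeonhole; any?; toℕ-fromℕ<; toℕ≤pred[n])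
open import Data.Fin.Permutation using (Permutation′; _⟨$⟩ʳ_; _⟨$⟩ˡ_; inverseˡ; transpose; _∘ₚ_)
open import Data.Vec using (Vec; []; _∷_; lookup; map; sum; insertAt; removeAt; _[_]≔_)
open import Data.Vec.Properties using (lookup-map; map-[]≔; insertAt-lookup; removeAt-insertAt; insertAt-removeAt; lookup∘updateAt; lookup∘updateAt′; []≔-idempotent; []≔-lookup; ∷-injectiveˡ; ∷-injectiveʳ)
open import Data.Bool using (if_then_else_)
open import Data.Product using (Σ; _×_; _,_; proj₁; proj₂)
open import Data.Sum using (_⊎_; inj₁; inj₂)
open import Relation.Nullary using (¬_; yes; no; contradiction)
open import Relation.Binary.Definitions using (tri<; tri≈; tri>)
open import Relation.Binary.PropositionalEquality
open import Function using (_∘′_)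

parity-suc : ∀ n → parity (suc n) ≡ parity n ⁻¹
parity-suc = +-homo-+ 1

⊕-⁻¹ : ∀ p q → p ⊕ q ⁻¹ ≡ (p ⊕ q) ⁻¹
⊕-⁻¹ 0ℙ q = refl
⊕-⁻¹ 1ℙ q = refl

⁻¹-⊕ : ∀ p q → p ⁻¹ ⊕ q ≡ p ⊕ q ⁻¹
⁻¹-⊕ 0ℙ q = refl
⁻¹-⊕ 1ℙ q = sym (⁻¹-involutive q)

⊕-cancelˡ : ∀ p q → p ⊕ (p ⊕ q) ≡ q
⊕-cancelˡ p q = trans (sym (ℙ.+-assoc p p q)) (cong (_⊕ q) (p+p≡0ℙ p))

IsEven⇒parity≡0ℙ : ∀ k → IsEven k → parity k ≡ 0ℙ
IsEven⇒parity≡0ℙ zero          _ = refl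
IsEven⇒parity≡0ℙ (suc zero)    ()
IsEven⇒parity≡0ℙ (suc (suc k)) e = IsEven⇒parity≡0ℙ k e

parity≡0ℙ⇒IsEven : ∀ k → parity k ≡ 0ℙ → IsEven k
parity≡0ℙ⇒IsEven zero          _ = refl
parity≡0ℙ⇒IsEven (suc zero)    ()
parity≡0ℙ⇒IsEven (suc (suc k)) e = parity≡0ℙ⇒IsEven k e

module _ {A : Set} where

  swapHead : ∀ {k} → Vec A (suc k) → Fin k → Vec A (suc k)
  swapHead (a ∷ r) k = lookup r k ∷ (r [ k ]≔ a)

  swapIf : ∀ {k} → Parity → Vec A k → Vec A k
  swapIf 0ℙ v = v
  swapIf 1ℙ v = swap01 v

  if-isEvenᵇ : ∀ {k} n (v : Vec A k) → (if isEvenᵇ n then v else swap01 v) ≡ swapIf (parity n) v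
  if-isEvenᵇ zero          v = refl
  if-isEvenᵇ (suc zero)    v = refl
  if-isEvenᵇ (suc (suc n)) v = if-isEvenᵇ n v

  swapHead-involutive : ∀ {k} (v : Vec A (suc k)) j → swapHead (swapHead v j) j ≡ v
  swapHead-involutive (a ∷ r) j = cong₂ _∷_ (lookup∘updateAt j r) (trans ([]≔-idempotent r j) ([]≔-lookup r j))

  swapIf-involutive : ∀ {k} p (v : Vec A k) → swapIf p (swapIf p v) ≡ v
  swapIf-involutive 0ℙ v = refl
  swapIf-involutive 1ℙ []          = refl
  swapIf-involutive 1ℙ (a ∷ [])    = refl
  swapIf-involutive 1ℙ (a ∷ b ∷ r) = refl

  swapIf-injective : ∀ {k} p {v w : Vec A k} → swapIf p v ≡ swapIf p w → v ≡ w
  swapIf-injective p {v} {w} e = trans (sym (swapIf-involutive p v)) (trans (cong (swapIf p) e) (swapIf-involutive p w))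

  lookup-swapIf : ∀ {k} p (v : Vec A (suc (suc k))) j → lookup (swapIf p v) (suc (suc j)) ≡ lookup v (suc (suc j))
  lookup-swapIf 0ℙ v           j = refl
  lookup-swapIf 1ℙ (a ∷ b ∷ r) j = refl

map-swapHead : ∀ {A B : Set} {k} (f : A → B) (v : Vec A (suc k)) j → map f (swapHead v j) ≡ swapHead (map f v) j
map-swapHead f (a ∷ r) j = cong₂ _∷_ (sym (lookup-map j f r)) (map-[]≔ f r j)

module _ {A : Set} where

  Distinct : ∀ {k} → Vec A k → Set
  Distinct {k} v = (p q : Fin k) → lookup v p ≡ lookup v q → p ≡ q

  _∉_ : ∀ {k} → A → Vec A k → Set
  c ∉ s = ∀ q → lookup s q ≢ c

  Distinct-reindex : ∀ {k l} (v : Vec A k) (w : Vec A l) (π : Fin l → Fin k) →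
    (∀ p q → π p ≡ π q → p ≡ q) → (∀ q → lookup w q ≡ lookup v (π q)) → Distinct v → Distinct w
  Distinct-reindex v w π π-inj w≗v∘π d p q e = π-inj p q (d (π p) (π q) (trans (sym (w≗v∘π p)) (trans e (w≗v∘π q))))

  Distinct-permute : ∀ {k} (v w : Vec A k) (π : Permutation′ k) →
    (∀ q → lookup w q ≡ lookup v (π ⟨$⟩ʳ q)) → Distinct v → Distinct w
  Distinct-permute v w π = Distinct-reindex v w (π ⟨$⟩ʳ_) λ p q e →
    trans (sym (inverseˡ π)) (trans (cong (π ⟨$⟩ˡ_) e) (inverseˡ π))

  Distinct-tail : ∀ {k} a (r : Vec A k) → Distinct (a ∷ r) → Distinct r
  Distinct-tail a r = Distinct-reindex (a ∷ r) r suc (λ p q → suc-injective) (λ q → refl)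

  lookup-removeAt : ∀ {k} (v : Vec A (suc k)) j q → lookup (removeAt v j) q ≡ lookup v (punchIn j q)
  lookup-removeAt (x ∷ xs)     zero    q       = refl
  lookup-removeAt (x ∷ y ∷ xs) (suc j) zero    = refl
  lookup-removeAt (x ∷ y ∷ xs) (suc j) (suc q) = lookup-removeAt (y ∷ xs) j q

  Distinct-removeAt : ∀ {k} (v : Vec A (suc k)) j → Distinct v → Distinct (removeAt v j)
  Distinct-removeAt v j = Distinct-reindex v (removeAt v j) (punchIn j) (punchIn-injective j) (lookup-removeAt v j)

  Distinct-swap01 : ∀ {k} (v : Vec A k) → Distinct v → Distinct (swap01 v)
  Distinct-swap01 []          d = d
  Distinct-swap01 (a ∷ [])    d = d
  Distinct-swap01 (a ∷ b ∷ r) = Distinct-permute (a ∷ b ∷ r) (b ∷ a ∷ r) (transpose zero (suc zero))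
    λ { zero → refl ; (suc zero) → refl ; (suc (suc q)) → refl }

  Distinct-swapIf : ∀ {k} p (v : Vec A k) → Distinct v → Distinct (swapIf p v)
  Distinct-swapIf 0ℙ v d = d
  Distinct-swapIf 1ℙ v d = Distinct-swap01 v d

  Distinct-∷ : ∀ {k} c (s : Vec A k) → c ∉ s → Distinct s → Distinct (c ∷ s)
  Distinct-∷ c s c∉s d zero    zero    e = refl
  Distinct-∷ c s c∉s d zero    (suc q) e = contradiction (sym e) (c∉s q)
  Distinct-∷ c s c∉s d (suc p) zero    e = contradiction e (c∉s p)
  Distinct-∷ c s c∉s d (suc p) (suc q) e = cong suc (d p q e)

  ∉-insertAt : ∀ {k} {b c} (s : Vec A k) j → c ≢ b → b ∉ s → b ∉ insertAt s j c
  ∉-insertAt s       zero    c≢b b∉s zero    = c≢b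
  ∉-insertAt s       zero    c≢b b∉s (suc q) = b∉s q
  ∉-insertAt (a ∷ s) (suc j) c≢b b∉s zero    = b∉s zero
  ∉-insertAt (a ∷ s) (suc j) c≢b b∉s (suc q) = ∉-insertAt s j c≢b (λ q → b∉s (suc q)) q

  Distinct-insertAt : ∀ {k} c (s : Vec A k) j → c ∉ s → Distinct s → Distinct (insertAt s j c)
  Distinct-insertAt c s       zero    c∉s d = Distinct-∷ c s c∉s d
  Distinct-insertAt c (a ∷ s) (suc j) c∉s d =
    Distinct-∷ a (insertAt s j c) (∉-insertAt s j (λ c≡a → c∉s zero (sym c≡a)) a∉s)
      (Distinct-insertAt c s j (λ q → c∉s (suc q)) (Distinct-tail a s d))
    where
    a∉s : a ∉ s
    a∉s q e = contradiction (d (suc q) zero e) λ ()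

module _ {A B : Set} (f : A → B) where

  Distinct-map⁺ : ∀ {k} (x : Vec A k) → (∀ a b → f a ≡ f b → a ≡ b) → Distinct x → Distinct (map f x)
  Distinct-map⁺ x f-inj d p q e =
    d p q (f-inj _ _ (trans (sym (lookup-map p f x)) (trans e (lookup-map q f x))))

  Distinct-map⁻ : ∀ {k} (x : Vec A k) → Distinct (map f x) → Distinct x
  Distinct-map⁻ x d p q e = d p q (trans (lookup-map p f x) (trans (cong f e) (sym (lookup-map q f x))))

module _ {n : ℕ} (i : Fin (suc n)) where

  ∉-map-punchIn : ∀ {k} (x : Vec (Fin n) k) → i ∉ map (punchIn i) x
  ∉-map-punchIn x q e = punchInᵢ≢i i (lookup x q) (trans (sym (lookup-map q (punchIn i) x)) e)

  map-punchIn-injective : ∀ {k} {x y : Vec (Fin n) k} → map (punchIn i) x ≡ map (punchIn i) y → x ≡ y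
  map-punchIn-injective {x = []}    {[]}    e = refl
  map-punchIn-injective {x = a ∷ x} {b ∷ y} e =
    cong₂ _∷_ (punchIn-injective i a b (∷-injectiveˡ e)) (map-punchIn-injective (∷-injectiveʳ e))

  Distinct-map-punchIn : ∀ {k} (x : Vec (Fin n) k) → Distinct x → Distinct (map (punchIn i) x)
  Distinct-map-punchIn x = Distinct-map⁺ (punchIn i) x (punchIn-injective i)

  ∉⇒map-punchIn : ∀ {k} (s : Vec (Fin (suc n)) k) → i ∉ s → Σ (Vec (Fin n) k) λ x → map (punchIn i) x ≡ s
  ∉⇒map-punchIn []      i∉s = [] , refl
  ∉⇒map-punchIn (a ∷ s) i∉s with ∉⇒map-punchIn s (λ q → i∉s (suc q))
  ... | x , refl = punchOut (λ i≡a → i∉s zero (sym i≡a)) ∷ x , cong (_∷ map (punchIn i) x) (punchIn-punchOut _)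

Distinct⇒surjective : ∀ {n} (x : Vec (Fin n) n) → Distinct x → ∀ v → Σ (Fin n) λ q → lookup x q ≡ v
Distinct⇒surjective {suc n} x d v with any? (λ q → lookup x q ≟ v)
... | yes hit = hit
... | no miss with pigeonhole (n<1+n n) (λ q → punchOut {j = lookup x q} (λ v≡xq → miss (q , sym v≡xq)))
... | p , q , p<q , e = contradiction (cong toℕ (d p q (punchOut-injective {i = v} _ _ e))) (<⇒≢ p<q)

χ< : ℕ → ℕ → ℕ
χ< m       zero    = 0
χ< zero    (suc k) = 1
χ< (suc m) (suc k) = χ< m k

χ≡ : ℕ → ℕ → ℕ
χ≡ zero    zero    = 1
χ≡ zero    (suc k) = 0
χ≡ (suc m) zero    = 0
χ≡ (suc m) (suc k) = χ≡ m k

χ<-suc : ∀ m k → χ< m (suc k) ≡ χ< m k + χ≡ m k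
χ<-suc zero    zero    = refl
χ<-suc zero    (suc k) = refl
χ<-suc (suc m) zero    = refl
χ<-suc (suc m) (suc k) = χ<-suc m k

χ<-yes : ∀ {m k} → m < k → χ< m k ≡ 1
χ<-yes {zero}  {suc k} _         = refl
χ<-yes {suc m} {suc k} (s≤s m<k) = χ<-yes m<k

χ<-no : ∀ {m k} → ¬ m < k → χ< m k ≡ 0
χ<-no {m}     {zero}  _   = refl
χ<-no {zero}  {suc k} m≮k = contradiction (s≤s z≤n) m≮k
χ<-no {suc m} {suc k} m≮k = χ<-no (m≮k ∘′ s≤s)

χ≡-refl : ∀ m → χ≡ m m ≡ 1
χ≡-refl zero    = refl
χ≡-refl (suc m) = χ≡-refl m

χ≡-no : ∀ {m k} → m ≢ k → χ≡ m k ≡ 0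
χ≡-no {zero}  {zero}  m≢k = contradiction refl m≢k
χ≡-no {zero}  {suc k} _   = refl
χ≡-no {suc m} {zero}  _   = refl
χ≡-no {suc m} {suc k} m≢k = χ≡-no (m≢k ∘′ cong suc)

χ<-punchIn : ∀ {n} (i : Fin (suc n)) (b a : Fin n) → χ< (toℕ (punchIn i b)) (toℕ (punchIn i a)) ≡ χ< (toℕ b) (toℕ a)
χ<-punchIn zero    b       a       = refl
χ<-punchIn (suc i) zero    zero    = refl
χ<-punchIn (suc i) zero    (suc a) = refl
χ<-punchIn (suc i) (suc b) zero    = refl
χ<-punchIn (suc i) (suc b) (suc a) = χ<-punchIn i b a

χ<-punchIn-pivot : ∀ {n} (i : Fin (suc n)) (b : Fin n) → χ< (toℕ (punchIn i b)) (toℕ i) ≡ χ< (toℕ b) (toℕ i)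
χ<-punchIn-pivot zero    b       = refl
χ<-punchIn-pivot (suc i) zero    = refl
χ<-punchIn-pivot (suc i) (suc b) = χ<-punchIn-pivot i b

module _ {A : Set} (f : A → ℕ) where

  sum-map-0 : ∀ {k} (x : Vec A k) → (∀ q → f (lookup x q) ≡ 0) → sum (map f x) ≡ 0
  sum-map-0 []      _ = refl
  sum-map-0 (a ∷ x) z = cong₂ _+_ (z zero) (sum-map-0 x (λ q → z (suc q)))

  sum-map-+ : ∀ {k} (g h : A → ℕ) → (∀ a → f a ≡ g a + h a) → (x : Vec A k) →
    sum (map f x) ≡ sum (map g x) + sum (map h x)
  sum-map-+ g h f≗g+h []      = refl
  sum-map-+ g h f≗g+h (a ∷ x) = trans (cong₂ _+_ (f≗g+h a) (sum-map-+ g h f≗g+h x)) (interchange (g a) (h a) _ _)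

count-≡ : ∀ {n k} (x : Vec (Fin n) k) → Distinct x → ∀ q →
  sum (map (λ e → χ≡ (toℕ e) (toℕ (lookup x q))) x) ≡ 1
count-≡ (a ∷ x) d zero    = cong₂ _+_ (χ≡-refl (toℕ a))
  (sum-map-0 _ x (λ q → χ≡-no λ xq≡a → contradiction (d (suc q) zero (toℕ-injective xq≡a)) λ ()))
count-≡ (a ∷ x) d (suc q) = cong₂ _+_
  (χ≡-no λ a≡xq → contradiction (d zero (suc q) (toℕ-injective a≡xq)) λ ())
  (count-≡ x (Distinct-tail a x d) q)

count-< : ∀ {k} (x : Vec (Fin k) k) → Distinct x → ∀ l → l ≤ k → sum (map (λ e → χ< (toℕ e) l) x) ≡ l
count-< x d zero    _   = sum-map-0 _ x (λ q → refl)
count-< x d (suc l) l<k = begin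
  sum (map (λ e → χ< (toℕ e) (suc l)) x)                                      ≡⟨ sum-map-+ _ _ _ (λ e → χ<-suc (toℕ e) l) x ⟩
  sum (map (λ e → χ< (toℕ e) l) x) + sum (map (λ e → χ≡ (toℕ e) l) x)         ≡⟨ cong₂ _+_ (count-< x d l (<⇒≤ l<k)) count-l ⟩
  l + 1                                                                       ≡⟨ +-comm l 1 ⟩
  suc l                                                                       ∎
  where
  open ≡-Reasoning
  count-l : sum (map (λ e → χ≡ (toℕ e) l) x) ≡ 1
  count-l with Distinct⇒surjective x d (F.fromℕ< l<k)
  ... | q , xq≡l = subst (λ m → sum (map (λ e → χ≡ (toℕ e) m) x) ≡ 1)
                         (trans (cong toℕ xq≡l) (toℕ-fromℕ< l<k)) (count-≡ x d q)

module _ {m : ℕ} where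

  countBelow-∷-< : ∀ {k} {a b : Fin m} (r : Vec (Fin m) k) → b F.< a → countBelow a (b ∷ r) ≡ suc (countBelow a r)
  countBelow-∷-< {a = a} {b} r b<a with b <? a
  ... | yes _   = refl
  ... | no  b≮a = contradiction b<a b≮a

  countBelow-∷-≮ : ∀ {k} {a b : Fin m} (r : Vec (Fin m) k) → ¬ b F.< a → countBelow a (b ∷ r) ≡ countBelow a r
  countBelow-∷-≮ {a = a} {b} r b≮a with b <? a
  ... | yes b<a = contradiction b<a b≮a
  ... | no  _   = refl

  countBelow-∷ : ∀ {k} (a b : Fin m) (r : Vec (Fin m) k) → countBelow a (b ∷ r) ≡ χ< (toℕ b) (toℕ a) + countBelow a r
  countBelow-∷ a b r with b <? a
  ... | yes b<a = cong (_+ countBelow a r) (sym (χ<-yes b<a))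
  ... | no  b≮a = cong (_+ countBelow a r) (sym (χ<-no b≮a))

  countBelow-∷-cong : ∀ {k} (c b : Fin m) {r r′ : Vec (Fin m) k} → countBelow c r ≡ countBelow c r′ →
    countBelow c (b ∷ r) ≡ countBelow c (b ∷ r′)
  countBelow-∷-cong c b e with b <? c
  ... | yes _ = cong suc e
  ... | no  _ = e

  countBelow-swap01 : ∀ {k} (c x y : Fin m) (s : Vec (Fin m) k) → countBelow c (x ∷ y ∷ s) ≡ countBelow c (y ∷ x ∷ s)
  countBelow-swap01 c x y s = begin
    countBelow c (x ∷ y ∷ s)                                   ≡⟨ countBelow-∷ c x _ ⟩
    χ< (toℕ x) (toℕ c) + countBelow c (y ∷ s)                  ≡⟨ cong (_ +_) (countBelow-∷ c y s) ⟩
    χ< (toℕ x) (toℕ c) + (χ< (toℕ y) (toℕ c) + countBelow c s) ≡⟨ x∙yz≈y∙xz (χ< (toℕ x) (toℕ c)) (χ< (toℕ y) (toℕ c)) (countBelow c s) ⟩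
    χ< (toℕ y) (toℕ c) + (χ< (toℕ x) (toℕ c) + countBelow c s) ≡⟨ cong (_ +_) (countBelow-∷ c x s) ⟨
    χ< (toℕ y) (toℕ c) + countBelow c (x ∷ s)                  ≡⟨ countBelow-∷ c y _ ⟨
    countBelow c (y ∷ x ∷ s)                                   ∎
    where open ≡-Reasoning

  countBelow-swapHead : ∀ {k} (c : Fin m) (v : Vec (Fin m) (suc k)) j → countBelow c (swapHead v j) ≡ countBelow c v
  countBelow-swapHead c (a ∷ b ∷ r) zero    = countBelow-swap01 c b a r
  countBelow-swapHead c (a ∷ b ∷ r) (suc j) = begin
    countBelow c (lookup r j ∷ b ∷ (r [ j ]≔ a))  ≡⟨ countBelow-swap01 c (lookup r j) b _ ⟩
    countBelow c (b ∷ swapHead (a ∷ r) j)        ≡⟨ countBelow-∷-cong c b (countBelow-swapHead c (a ∷ r) j) ⟩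
    countBelow c (b ∷ a ∷ r)                     ≡⟨ countBelow-swap01 c b a r ⟩
    countBelow c (a ∷ b ∷ r)                     ∎
    where open ≡-Reasoning

  countBelow-insertAt : ∀ {k} (b c : Fin m) (s : Vec (Fin m) k) j → countBelow b (insertAt s j c) ≡ countBelow b (c ∷ s)
  countBelow-insertAt b c s       zero    = refl
  countBelow-insertAt b c (a ∷ s) (suc j) =
    trans (countBelow-∷-cong b a (countBelow-insertAt b c s j)) (countBelow-swap01 b a c s)

  inversions-swap01-< : ∀ {k} {x y : Fin m} (s : Vec (Fin m) k) → x F.< y →
    inversions (y ∷ x ∷ s) ≡ suc (inversions (x ∷ y ∷ s))
  inversions-swap01-< {x = x} {y} s x<y = begin
    countBelow y (x ∷ s) + (countBelow x s + inversions s)  ≡⟨ cong (_+ _) (countBelow-∷-< s x<y) ⟩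
    suc (countBelow y s + (countBelow x s + inversions s))  ≡⟨ cong suc (x∙yz≈y∙xz (countBelow y s) (countBelow x s) (inversions s)) ⟩
    suc (countBelow x s + (countBelow y s + inversions s))  ≡⟨ cong (λ z → suc (z + _)) (countBelow-∷-≮ s (<-asym x<y)) ⟨
    suc (countBelow x (y ∷ s) + (countBelow y s + inversions s)) ∎
    where open ≡-Reasoning

module _ {n : ℕ} (i : Fin (suc n)) where

  countBelow-map-punchIn : ∀ {k} (a : Fin n) (r : Vec (Fin n) k) →
    countBelow (punchIn i a) (map (punchIn i) r) ≡ countBelow a r
  countBelow-map-punchIn a []      = refl
  countBelow-map-punchIn a (b ∷ r) = begin
    countBelow (punchIn i a) (punchIn i b ∷ map (punchIn i) r)  ≡⟨ countBelow-∷ (punchIn i a) (punchIn i b) _ ⟩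
    χ< (toℕ (punchIn i b)) (toℕ (punchIn i a)) + countBelow (punchIn i a) (map (punchIn i) r)
      ≡⟨ cong₂ _+_ (χ<-punchIn i b a) (countBelow-map-punchIn a r) ⟩
    χ< (toℕ b) (toℕ a) + countBelow a r                         ≡⟨ countBelow-∷ a b r ⟨
    countBelow a (b ∷ r)                                        ∎
    where open ≡-Reasoning

  inversions-map-punchIn : ∀ {k} (r : Vec (Fin n) k) → inversions (map (punchIn i) r) ≡ inversions r
  inversions-map-punchIn []      = refl
  inversions-map-punchIn (a ∷ r) = cong₂ _+_ (countBelow-map-punchIn a r) (inversions-map-punchIn r)

  countBelow-pivot-sum : ∀ {k} (x : Vec (Fin n) k) →
    countBelow i (map (punchIn i) x) ≡ sum (map (λ e → χ< (toℕ e) (toℕ i)) x)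
  countBelow-pivot-sum []      = refl
  countBelow-pivot-sum (a ∷ x) = trans (countBelow-∷ i (punchIn i a) _)
    (cong₂ _+_ (χ<-punchIn-pivot i a) (countBelow-pivot-sum x))

  countBelow-pivot : (x : Tuple n) → IsPerm x → countBelow i (map (punchIn i) x) ≡ toℕ i
  countBelow-pivot x d = trans (countBelow-pivot-sum x) (count-< x d (toℕ i) (toℕ≤pred[n] i))

sign : ∀ {m k} → Vec (Fin m) k → Parity
sign v = parity (inversions v)

module _ {m : ℕ} where

  sign-∷ : ∀ {k} (c : Fin m) (s : Vec (Fin m) k) → sign (c ∷ s) ≡ parity (countBelow c s) ⊕ sign s
  sign-∷ c s = +-homo-+ (countBelow c s) (inversions s)

  sign-∷-flip : ∀ {k} (c : Fin m) {s s′ : Vec (Fin m) k} → countBelow c s′ ≡ countBelow c s →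
    sign s′ ≡ sign s ⁻¹ → sign (c ∷ s′) ≡ sign (c ∷ s) ⁻¹
  sign-∷-flip c {s} {s′} same-count flipped = begin
    sign (c ∷ s′)                          ≡⟨ sign-∷ c s′ ⟩
    parity (countBelow c s′) ⊕ sign s′     ≡⟨ cong₂ _⊕_ (cong parity same-count) flipped ⟩
    parity (countBelow c s) ⊕ sign s ⁻¹    ≡⟨ ⊕-⁻¹ (parity (countBelow c s)) (sign s) ⟩
    (parity (countBelow c s) ⊕ sign s) ⁻¹  ≡⟨ cong _⁻¹ (sign-∷ c s) ⟨
    sign (c ∷ s) ⁻¹                        ∎
    where open ≡-Reasoning

  sign-swap01 : ∀ {k} (x y : Fin m) (s : Vec (Fin m) k) → x ≢ y → sign (y ∷ x ∷ s) ≡ sign (x ∷ y ∷ s) ⁻¹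
  sign-swap01 x y s x≢y with <-cmp (toℕ x) (toℕ y)
  ... | tri< x<y _ _ = trans (cong parity (inversions-swap01-< s x<y)) (parity-suc (inversions (x ∷ y ∷ s)))
  ... | tri≈ _ x≡y _ = contradiction (toℕ-injective x≡y) x≢y
  ... | tri> _ _ y<x = sym (trans (cong (λ k → parity k ⁻¹) (inversions-swap01-< s y<x))
                                  (trans (cong _⁻¹ (parity-suc (inversions (y ∷ x ∷ s)))) (⁻¹-involutive (sign (y ∷ x ∷ s)))))

  sign-swapIf : ∀ {k} p (w : Vec (Fin m) (suc (suc k))) → Distinct w → sign (swapIf p w) ≡ p ⊕ sign w
  sign-swapIf 0ℙ w           d = refl
  sign-swapIf 1ℙ (x ∷ y ∷ s) d = sign-swap01 x y s λ x≡y → contradiction (d zero (suc zero) x≡y) λ ()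

  sign-swapHead : ∀ {k} (v : Vec (Fin m) (suc k)) j → Distinct v → sign (swapHead v j) ≡ sign v ⁻¹
  sign-swapHead (a ∷ b ∷ r) zero    d = sign-swap01 a b r λ a≡b → contradiction (d zero (suc zero) a≡b) λ ()
  sign-swapHead (a ∷ b ∷ r) (suc j) d = begin
    sign (lookup r j ∷ b ∷ (r [ j ]≔ a))
      ≡⟨ sign-swap01 b (lookup r j) (r [ j ]≔ a) (λ b≡c → contradiction (d (suc zero) (suc (suc j)) b≡c) λ ()) ⟩
    sign (b ∷ swapHead (a ∷ r) j) ⁻¹      ≡⟨ cong _⁻¹ (sign-∷-flip b (countBelow-swapHead b (a ∷ r) j) (sign-swapHead (a ∷ r) j d′)) ⟩
    sign (b ∷ a ∷ r) ⁻¹ ⁻¹                ≡⟨ ⁻¹-involutive (sign (b ∷ a ∷ r)) ⟩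
    sign (b ∷ a ∷ r)                      ≡⟨ sign-swap01 a b r (λ a≡b → contradiction (d zero (suc zero) a≡b) λ ()) ⟩
    sign (a ∷ b ∷ r) ⁻¹                   ∎
    where
    open ≡-Reasoning
    d′ : Distinct (a ∷ r)
    d′ = Distinct-tail b (a ∷ r) (Distinct-swap01 (a ∷ b ∷ r) d)

  sign-insertAt : ∀ {k} (c : Fin m) (s : Vec (Fin m) k) j → c ∉ s → sign (insertAt s j c) ≡ sign (c ∷ s) ⊕ parity (toℕ j)
  sign-insertAt c s       zero    c∉s = sym (ℙ.+-identityʳ _)
  sign-insertAt c (b ∷ s) (suc j) c∉s = begin
    sign (b ∷ insertAt s j c)                                   ≡⟨ sign-∷ b (insertAt s j c) ⟩
    parity (countBelow b (insertAt s j c)) ⊕ sign (insertAt s j c)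
      ≡⟨ cong₂ _⊕_ (cong parity (countBelow-insertAt b c s j)) (sign-insertAt c s j (λ q → c∉s (suc q))) ⟩
    parity (countBelow b (c ∷ s)) ⊕ (sign (c ∷ s) ⊕ parity (toℕ j)) ≡⟨ ℙ.+-assoc (parity (countBelow b (c ∷ s))) (sign (c ∷ s)) _ ⟨
    (parity (countBelow b (c ∷ s)) ⊕ sign (c ∷ s)) ⊕ parity (toℕ j) ≡⟨ cong (_⊕ parity (toℕ j)) (sign-∷ b (c ∷ s)) ⟨
    sign (b ∷ c ∷ s) ⊕ parity (toℕ j)                           ≡⟨ cong (_⊕ parity (toℕ j)) (sign-swap01 c b s (λ c≡b → c∉s zero (sym c≡b))) ⟩
    sign (c ∷ b ∷ s) ⁻¹ ⊕ parity (toℕ j)                        ≡⟨ ⁻¹-⊕ (sign (c ∷ b ∷ s)) (parity (toℕ j)) ⟩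
    sign (c ∷ b ∷ s) ⊕ parity (toℕ j) ⁻¹                        ≡⟨ cong (sign (c ∷ b ∷ s) ⊕_) (parity-suc (toℕ j)) ⟨
    sign (c ∷ b ∷ s) ⊕ parity (suc (toℕ j))                     ∎
    where open ≡-Reasoning

sign-pivot : ∀ {n} (i : Fin (suc n)) (x : Tuple n) → IsPerm x → sign (i ∷ map (punchIn i) x) ≡ parity (toℕ i) ⊕ sign x
sign-pivot i x d = trans (sign-∷ i (map (punchIn i) x)) (cong₂ _⊕_ (cong parity (countBelow-pivot i x d)) (cong parity (inversions-map-punchIn i x)))

-- An arc permutes positions by the 3-cycle 0 ↦ 1 ↦ k + 2 ↦ 0, a product of two transpositions.
module _ {m : ℕ} where

  Distinct-Arc : (v w : Tuple (suc (suc m))) → Distinct v → Arc v w → Distinct w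
  Distinct-Arc (v0 ∷ v1 ∷ r) w d (k , refl) =
    Distinct-permute (v0 ∷ v1 ∷ r) w (transpose zero (suc (suc k)) ∘ₚ transpose zero (suc zero)) lookup-Arc d
    where
    lookup-Arc : ∀ q → lookup w q ≡ lookup (v0 ∷ v1 ∷ r)
                   ((transpose zero (suc (suc k)) ∘ₚ transpose zero (suc zero)) ⟨$⟩ʳ q)
    lookup-Arc zero          = refl
    lookup-Arc (suc zero)    = refl
    lookup-Arc (suc (suc q)) with q ≟ k
    ... | yes refl = lookup∘updateAt q r
    ... | no q≢k   = lookup∘updateAt′ q k q≢k r

  sign-Arc : (v w : Tuple (suc (suc m))) → Distinct v → Arc v w → sign w ≡ sign v
  sign-Arc (v0 ∷ v1 ∷ r) w d (k , refl) = begin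
    sign (lookup r k ∷ v0 ∷ (r [ k ]≔ v1))
      ≡⟨ sign-swap01 v0 (lookup r k) _ (λ v0≡rk → contradiction (d zero (suc (suc k)) v0≡rk) λ ()) ⟩
    sign (v0 ∷ swapHead (v1 ∷ r) k) ⁻¹      ≡⟨ cong _⁻¹ (sign-∷-flip v0 (countBelow-swapHead v0 (v1 ∷ r) k)
                                                 (sign-swapHead (v1 ∷ r) k (Distinct-tail v0 (v1 ∷ r) d))) ⟩
    sign (v0 ∷ v1 ∷ r) ⁻¹ ⁻¹                ≡⟨ ⁻¹-involutive (sign (v0 ∷ v1 ∷ r)) ⟩
    sign (v0 ∷ v1 ∷ r)                      ∎
    where open ≡-Reasoning

module StarCopy {m : ℕ} (i : Fin (suc (suc m))) where

  lift : Tuple (suc m) → Tuple (suc (suc m))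
  lift σ = i ∷ map (punchIn i) σ

  embed : Tuple (suc m) → Tuple (suc (suc m))
  embed σ = swapIf (sign (lift σ)) (lift σ)

  lift-injective : ∀ {σ τ} → lift σ ≡ lift τ → σ ≡ τ
  lift-injective e = map-punchIn-injective i (∷-injectiveʳ e)

  Distinct-lift : ∀ σ → IsPerm σ → Distinct (lift σ)
  Distinct-lift σ d = Distinct-∷ i _ (∉-map-punchIn i σ) (Distinct-map-punchIn i σ d)

  lift-surjective : ∀ s → Distinct (i ∷ s) → Σ (Tuple (suc m)) λ σ → IsPerm σ × lift σ ≡ i ∷ s
  lift-surjective s d with ∉⇒map-punchIn i s (λ q iq≡i → contradiction (d (suc q) zero iq≡i) λ ())
  ... | σ , refl = σ , Distinct-map⁻ (punchIn i) σ (Distinct-tail i _ d) , refl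

  embed-from-lift : ∀ {σ u p} → lift σ ≡ u → sign u ≡ p → embed σ ≡ swapIf p u
  embed-from-lift refl refl = refl

  IsAlt-embed : ∀ σ → IsPerm σ → IsAlt (embed σ)
  IsAlt-embed σ d =
    Distinct-swapIf p (lift σ) (Distinct-lift σ d) ,
    parity≡0ℙ⇒IsEven (inversions (embed σ)) (trans (sign-swapIf p (lift σ) (Distinct-lift σ d)) (p+p≡0ℙ p))
    where p = sign (lift σ)

  embed-InSTi : ∀ σ → IsPerm σ → InSTi i (embed σ)
  embed-InSTi σ@(a ∷ r) d = IsAlt-embed σ d , pivot-in-front (sign (lift σ))
    where
    pivot-in-front : ∀ p → Entry0≡ i (swapIf p (lift σ)) ⊎ Entry1≡ i (swapIf p (lift σ))
    pivot-in-front 0ℙ = inj₁ refl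
    pivot-in-front 1ℙ = inj₂ refl

  embed-surjective : ∀ v → InSTi i v → Σ (Tuple (suc m)) λ σ → IsPerm σ × embed σ ≡ v
  embed-surjective (.i ∷ s) ((d , even) , inj₁ refl) with lift-surjective s d
  ... | σ , dσ , lift≡ = σ , dσ , embed-from-lift lift≡ (IsEven⇒parity≡0ℙ (inversions (i ∷ s)) even)
  embed-surjective (v0 ∷ .i ∷ r) ((d , even) , inj₂ refl) with lift-surjective (v0 ∷ r) (Distinct-swap01 (v0 ∷ i ∷ r) d)
  ... | σ , dσ , lift≡ = σ , dσ , embed-from-lift lift≡ odd
    where
    odd : sign (i ∷ v0 ∷ r) ≡ 1ℙ
    odd = trans (sign-swap01 v0 i r (λ v0≡i → contradiction (d zero (suc zero) v0≡i) λ ()))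
                (cong _⁻¹ (IsEven⇒parity≡0ℙ (inversions (v0 ∷ i ∷ r)) even))

  swapIf-lift-injective : ∀ p q σ τ → swapIf p (lift σ) ≡ swapIf q (lift τ) → σ ≡ τ
  swapIf-lift-injective 0ℙ 0ℙ σ       τ       e = lift-injective e
  swapIf-lift-injective 1ℙ 1ℙ σ       τ       e = lift-injective (swapIf-injective 1ℙ e)
  swapIf-lift-injective 0ℙ 1ℙ σ       (b ∷ t) e = contradiction (sym (∷-injectiveˡ e)) (punchInᵢ≢i i b)
  swapIf-lift-injective 1ℙ 0ℙ (a ∷ r) τ       e = contradiction (∷-injectiveˡ e) (punchInᵢ≢i i a)

  embed-injective : ∀ σ τ → embed σ ≡ embed τ → σ ≡ τ
  embed-injective σ τ = swapIf-lift-injective (sign (lift σ)) (sign (lift τ)) σ τ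

  STAdj-sym : ∀ (σ τ : Tuple (suc m)) → STAdj σ τ → STAdj τ σ
  STAdj-sym (a ∷ r) τ (k , refl) = k , sym (swapHead-involutive (a ∷ r) k)

  STAdj⇒Arc-lift : ∀ (σ τ : Tuple (suc m)) → STAdj σ τ → Arc (lift σ) (swap01 (lift τ))
  STAdj⇒Arc-lift σ@(a ∷ r) τ (k , refl) = k , cong (λ t → swap01 (i ∷ t)) (map-swapHead (punchIn i) σ k)

  Arc-lift⇒STAdj : ∀ (σ τ : Tuple (suc m)) → Arc (lift σ) (swap01 (lift τ)) → STAdj σ τ
  Arc-lift⇒STAdj σ@(a ∷ r) (c ∷ t) (k , e) =
    k , lift-injective (cong (i ∷_) (trans (cong₂ _∷_ (∷-injectiveˡ e) (∷-injectiveʳ (∷-injectiveʳ e)))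
                                           (sym (map-swapHead (punchIn i) σ k))))

  sign-lift-STAdj : ∀ (σ τ : Tuple (suc m)) → IsPerm σ → STAdj σ τ → sign (lift τ) ≡ sign (lift σ) ⁻¹
  sign-lift-STAdj σ@(a ∷ r) τ d (k , refl) =
    trans (cong (λ t → sign (i ∷ t)) (map-swapHead (punchIn i) σ k))
          (sign-∷-flip i (countBelow-swapHead i (map (punchIn i) σ) k)
                         (sign-swapHead (map (punchIn i) σ) k (Distinct-map-punchIn i σ d)))

  embed-phase : ∀ (σ : Tuple (suc m)) {p} → sign (lift σ) ≡ p → embed σ ≡ swapIf p (lift σ)
  embed-phase σ = embed-from-lift refl

  STAdj⇒Arc-embed : ∀ (σ τ : Tuple (suc m)) → IsPerm σ → STAdj σ τ → Arc (embed σ) (embed τ) ⊎ Arc (embed τ) (embed σ)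
  STAdj⇒Arc-embed σ τ d adj = oriented (sign (lift σ)) refl (sign-lift-STAdj σ τ d adj)
    where
    oriented : ∀ p → sign (lift σ) ≡ p → sign (lift τ) ≡ p ⁻¹ → Arc (embed σ) (embed τ) ⊎ Arc (embed τ) (embed σ)
    oriented 0ℙ sσ sτ rewrite embed-phase σ sσ | embed-phase τ sτ = inj₁ (STAdj⇒Arc-lift σ τ adj)
    oriented 1ℙ sσ sτ rewrite embed-phase σ sσ | embed-phase τ sτ = inj₂ (STAdj⇒Arc-lift τ σ (STAdj-sym σ τ adj))

  Arc-oriented : ∀ (v w : Tuple (suc (suc m))) → InSTi i v → InSTi i w → Arc v w → Entry0≡ i v × Entry1≡ i w
  Arc-oriented (v0 ∷ v1 ∷ r) w (_ , inj₁ v0≡i) _ (k , refl) = v0≡i , v0≡i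
  Arc-oriented (v0 ∷ v1 ∷ r) w _ (_ , inj₂ v0≡i) (k , refl) = v0≡i , v0≡i
  Arc-oriented (v0 ∷ v1 ∷ r) w ((d , _) , inj₂ v1≡i) ((_ , _) , inj₁ rk≡i) (k , refl) =
    contradiction (d (suc zero) (suc (suc k)) (trans v1≡i (sym rk≡i))) λ ()

  front⇒even : ∀ p (σ : Tuple (suc m)) → Entry0≡ i (swapIf p (lift σ)) → p ≡ 0ℙ
  front⇒even 0ℙ σ       _    = refl
  front⇒even 1ℙ (a ∷ r) a≡i = contradiction a≡i (punchInᵢ≢i i a)

  second⇒odd : ∀ p (σ : Tuple (suc m)) → Entry1≡ i (swapIf p (lift σ)) → p ≡ 1ℙ
  second⇒odd 0ℙ (a ∷ r) a≡i = contradiction a≡i (punchInᵢ≢i i a)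
  second⇒odd 1ℙ σ       _    = refl

  Arc-embed⇒STAdj : ∀ (σ τ : Tuple (suc m)) → IsPerm σ → IsPerm τ → Arc (embed σ) (embed τ) → STAdj σ τ
  Arc-embed⇒STAdj σ τ dσ dτ arc with Arc-oriented (embed σ) (embed τ) (embed-InSTi σ dσ) (embed-InSTi τ dτ) arc
  ... | σ-front , τ-second =
    Arc-lift⇒STAdj σ τ
      (subst₂ Arc (embed-phase σ (front⇒even _ σ σ-front)) (embed-phase τ (second⇒odd _ τ τ-second)) arc)

  Neighbour⇒i-at-position≥2 : ∀ (v : Tuple (suc (suc m))) → NeighbourOf i v →
    Σ (Fin m) λ k → lookup v (suc (suc k)) ≡ i
  Neighbour⇒i-at-position≥2 (v0 ∷ v1 ∷ r) (alt , v∉ , w , (_ , inj₁ rk≡i) , inj₁ (k , refl)) = k , rk≡i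
  Neighbour⇒i-at-position≥2 (v0 ∷ v1 ∷ r) (alt , v∉ , w , (_ , inj₂ v0≡i) , inj₁ (k , refl)) =
    contradiction (alt , inj₁ v0≡i) v∉
  Neighbour⇒i-at-position≥2 (.(lookup s k) ∷ .w0 ∷ .(s [ k ]≔ w1)) (alt , v∉ , w0 ∷ w1 ∷ s , (_ , inj₁ w0≡i) , inj₂ (k , refl)) =
    contradiction (alt , inj₂ w0≡i) v∉
  Neighbour⇒i-at-position≥2 (.(lookup s k) ∷ .w0 ∷ .(s [ k ]≔ w1)) (alt , v∉ , w0 ∷ w1 ∷ s , (_ , inj₂ w1≡i) , inj₂ (k , refl)) =
    k , trans (lookup∘updateAt k s) w1≡i

  i-at-position≥2⇒Neighbour : ∀ (v : Tuple (suc (suc m))) k → IsAlt v → lookup v (suc (suc k)) ≡ i → NeighbourOf i v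
  i-at-position≥2⇒Neighbour v@(v0 ∷ v1 ∷ r) k alt@(d , even) rk≡i =
    alt , v∉ , w , ((Distinct-Arc v w d arc , even-w) , inj₁ rk≡i) , inj₁ arc
    where
    w = lookup r k ∷ v0 ∷ (r [ k ]≔ v1)
    arc : Arc v w
    arc = k , refl
    even-w : IsEven (inversions w)
    even-w = parity≡0ℙ⇒IsEven (inversions w) (trans (sign-Arc v w d arc) (IsEven⇒parity≡0ℙ (inversions v) even))
    v∉ : ¬ InSTi i v
    v∉ (_ , inj₁ v0≡i) = contradiction (d zero (suc (suc k)) (trans v0≡i (sym rk≡i))) λ ()
    v∉ (_ , inj₂ v1≡i) = contradiction (d (suc zero) (suc (suc k)) (trans v1≡i (sym rk≡i))) λ ()

  inserted : Fin (suc (suc m)) → Tuple (suc m) → Tuple (suc (suc m))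
  inserted j x = insertAt (map (punchIn i) x) j i

  ζ≡swapIf : ∀ j x → ζ (suc m) i j x ≡ swapIf (parity (toℕ i + toℕ j)) (inserted j x)
  ζ≡swapIf j x = if-isEvenᵇ (toℕ i + toℕ j) (inserted j x)

  Distinct-inserted : ∀ j x → IsPerm x → Distinct (inserted j x)
  Distinct-inserted j x d = Distinct-insertAt i (map (punchIn i) x) j (∉-map-punchIn i x) (Distinct-map-punchIn i x d)

  sign-inserted : ∀ j x → IsPerm x → sign (inserted j x) ≡ parity (toℕ i + toℕ j) ⊕ sign x
  sign-inserted j x d = begin
    sign (inserted j x)                                 ≡⟨ sign-insertAt i (map (punchIn i) x) j (∉-map-punchIn i x) ⟩
    sign (i ∷ map (punchIn i) x) ⊕ parity (toℕ j)       ≡⟨ cong (_⊕ parity (toℕ j)) (sign-pivot i x d) ⟩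
    parity (toℕ i) ⊕ sign x ⊕ parity (toℕ j)            ≡⟨ ⊕-xy∙z≈xz∙y (parity (toℕ i)) (sign x) (parity (toℕ j)) ⟩
    parity (toℕ i) ⊕ parity (toℕ j) ⊕ sign x            ≡⟨ cong (_⊕ sign x) (+-homo-+ (toℕ i) (toℕ j)) ⟨
    parity (toℕ i + toℕ j) ⊕ sign x                     ∎
    where open ≡-Reasoning

  sign-ζ : ∀ j x → IsPerm x → sign (ζ (suc m) i j x) ≡ sign x
  sign-ζ j x d = begin
    sign (ζ (suc m) i j x)          ≡⟨ cong sign (ζ≡swapIf j x) ⟩
    sign (swapIf p (inserted j x))  ≡⟨ sign-swapIf p (inserted j x) (Distinct-inserted j x d) ⟩
    p ⊕ sign (inserted j x)         ≡⟨ cong (p ⊕_) (sign-inserted j x d) ⟩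
    p ⊕ (p ⊕ sign x)                ≡⟨ ⊕-cancelˡ p (sign x) ⟩
    sign x                          ∎
    where
    open ≡-Reasoning
    p = parity (toℕ i + toℕ j)

  Distinct-ζ : ∀ j x → IsPerm x → Distinct (ζ (suc m) i j x)
  Distinct-ζ j x d = subst Distinct (sym (ζ≡swapIf j x)) (Distinct-swapIf (parity (toℕ i + toℕ j)) (inserted j x) (Distinct-inserted j x d))

  IsAlt-ζ : ∀ j x → IsAlt x → IsAlt (ζ (suc m) i j x)
  IsAlt-ζ j x (d , even) =
    Distinct-ζ j x d ,
    parity≡0ℙ⇒IsEven (inversions (ζ (suc m) i j x)) (trans (sign-ζ j x d) (IsEven⇒parity≡0ℙ (inversions x) even))

  lookup-ζ : ∀ k x → lookup (ζ (suc m) i (suc (suc k)) x) (suc (suc k)) ≡ i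
  lookup-ζ k x = begin
    lookup (ζ (suc m) i j x) j        ≡⟨ cong (λ v → lookup v j) (ζ≡swapIf j x) ⟩
    lookup (swapIf p (inserted j x)) j ≡⟨ lookup-swapIf p (inserted j x) k ⟩
    lookup (inserted j x) j            ≡⟨ insertAt-lookup (map (punchIn i) x) j i ⟩
    i                                  ∎
    where
    open ≡-Reasoning
    j = suc (suc k)
    p = parity (toℕ i + toℕ j)

  ζ-preimage : ∀ k (v : Tuple (suc (suc m))) → IsAlt v → lookup v (suc (suc k)) ≡ i →
    Σ (Tuple (suc m)) λ x → IsAlt x × ζ (suc m) i (suc (suc k)) x ≡ v
  ζ-preimage k v (d , even) vj≡i = x , (dx , even-x) , ζx≡v
    where
    open ≡-Reasoning
    j = suc (suc k)
    p = parity (toℕ i + toℕ j)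
    u = swapIf p v
    du : Distinct u
    du = Distinct-swapIf p v d
    uj≡i : lookup u j ≡ i
    uj≡i = trans (lookup-swapIf p v k) vj≡i
    i∉ : i ∉ removeAt u j
    i∉ q uq≡i = punchInᵢ≢i j q (du _ _ (trans (sym (lookup-removeAt u j q)) (trans uq≡i (sym uj≡i))))
    x = proj₁ (∉⇒map-punchIn i (removeAt u j) i∉)
    x↦u = proj₂ (∉⇒map-punchIn i (removeAt u j) i∉)
    dx : IsPerm x
    dx = Distinct-map⁻ (punchIn i) x (subst Distinct (sym x↦u) (Distinct-removeAt u j du))
    ζx≡v : ζ (suc m) i j x ≡ v
    ζx≡v = begin
      ζ (suc m) i j x                                     ≡⟨ ζ≡swapIf j x ⟩
      swapIf p (insertAt (map (punchIn i) x) j i)         ≡⟨ cong (λ s → swapIf p (insertAt s j i)) x↦u ⟩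
      swapIf p (insertAt (removeAt u j) j i)              ≡⟨ cong (λ c → swapIf p (insertAt (removeAt u j) j c)) uj≡i ⟨
      swapIf p (insertAt (removeAt u j) j (lookup u j))   ≡⟨ cong (swapIf p) (insertAt-removeAt u j) ⟩
      swapIf p u                                          ≡⟨ swapIf-involutive p v ⟩
      v                                                   ∎
    even-x : IsEven (inversions x)
    even-x = parity≡0ℙ⇒IsEven (inversions x) (begin
      sign x                  ≡⟨ sign-ζ j x dx ⟨
      sign (ζ (suc m) i j x)  ≡⟨ cong sign ζx≡v ⟩
      sign v                  ≡⟨ IsEven⇒parity≡0ℙ (inversions v) even ⟩
      0ℙ                      ∎)

  ζ-injective : ∀ k k′ x x′ → IsPerm x → ζ (suc m) i (suc (suc k)) x ≡ ζ (suc m) i (suc (suc k′)) x′ →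
    Fin.suc (suc k) ≡ suc (suc k′) × x ≡ x′
  ζ-injective k k′ x x′ d e
    with Distinct-ζ (suc (suc k)) x d (suc (suc k)) (suc (suc k′))
           (trans (lookup-ζ k x) (sym (trans (cong (λ v → lookup v (suc (suc k′))) e) (lookup-ζ k′ x′))))
  ... | refl = refl , map-punchIn-injective i (begin
    map (punchIn i) x              ≡⟨ removeAt-insertAt (map (punchIn i) x) j i ⟨
    removeAt (inserted j x) j      ≡⟨ cong (λ v → removeAt v j) (swapIf-injective p (trans (sym (ζ≡swapIf j x)) (trans e (ζ≡swapIf j x′)))) ⟩
    removeAt (inserted j x′) j     ≡⟨ removeAt-insertAt (map (punchIn i) x′) j i ⟩
    map (punchIn i) x′             ∎)
    where
    open ≡-Reasoning
    j = suc (suc k)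
    p = parity (toℕ i + toℕ j)

  ζ-Image : Tuple (suc (suc m)) → Set
  ζ-Image v = Σ (Fin (suc (suc m))) λ j → 2 ≤ toℕ j × Σ (Tuple (suc m)) λ x → IsAlt x × ζ (suc m) i j x ≡ v

  Neighbour⇒ζ-Image : ∀ v → NeighbourOf i v → ζ-Image v
  Neighbour⇒ζ-Image v nb with Neighbour⇒i-at-position≥2 v nb
  ... | k , vj≡i = suc (suc k) , s≤s (s≤s z≤n) , ζ-preimage k v (proj₁ nb) vj≡i

  ζ-Image⇒Neighbour : ∀ v → ζ-Image v → NeighbourOf i v
  ζ-Image⇒Neighbour _ (suc zero    , s≤s () , _)
  ζ-Image⇒Neighbour _ (suc (suc k) , _ , x , alt , refl) = i-at-position≥2⇒Neighbour _ k (IsAlt-ζ _ x alt) (lookup-ζ k x)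

  ζ-disjoint : (j j′ : Fin (suc (suc m))) → 2 ≤ toℕ j → 2 ≤ toℕ j′ → (x x′ : Tuple (suc m)) →
    IsAlt x → IsAlt x′ → ζ (suc m) i j x ≡ ζ (suc m) i j′ x′ → j ≡ j′ × x ≡ x′
  ζ-disjoint (suc zero)    _              (s≤s ()) _
  ζ-disjoint _             (suc zero)     _        (s≤s ())
  ζ-disjoint (suc (suc k)) (suc (suc k′)) _        _ x x′ (d , _) _ = ζ-injective k k′ x x′ d

lemma5 : (n : ℕ) → 1 < n → (i : Fin (suc n)) →
    -- (1) ST_n^i is a copy of the star graph ST_n (underlying graph) ...
    (Σ (Tuple n → Tuple (suc n)) λ f →
        ((σ : Tuple n) → IsPerm σ → InSTi i (f σ))
      × ((v : Tuple (suc n)) → InSTi i v → Σ (Tuple n) λ σ → IsPerm σ × f σ ≡ v)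
      × ((σ τ : Tuple n) → IsPerm σ → IsPerm τ → f σ ≡ f τ → σ ≡ τ)
      × ((σ τ : Tuple n) → IsPerm σ → IsPerm τ →
           (STAdj σ τ → Arc (f σ) (f τ) ⊎ Arc (f τ) (f σ))
         × (Arc (f σ) (f τ) ⊎ Arc (f τ) (f σ) → STAdj σ τ)))
    -- ... with arcs oriented from 0th entry = i to 1st entry = i
    × ((v w : Tuple (suc n)) → InSTi i v → InSTi i w → Arc v w →
         Entry0≡ i v × Entry1≡ i w)
    -- (2) neighbours of ST_n^i = union of the images of ζ_n^{i,j}, 2 ≤ j ≤ n ...
    × ((v : Tuple (suc n)) →
           (NeighbourOf i v →
              Σ (Fin (suc n)) λ j → 2 ≤ toℕ j × Σ (Tuple n) λ x → IsAlt x × ζ n i j x ≡ v)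
         × ((Σ (Fin (suc n)) λ j → 2 ≤ toℕ j × Σ (Tuple n) λ x → IsAlt x × ζ n i j x ≡ v) →
              NeighbourOf i v))
    -- ... disjoint, each counted once
    × ((j j′ : Fin (suc n)) → 2 ≤ toℕ j → 2 ≤ toℕ j′ → (x x′ : Tuple n) →
         IsAlt x → IsAlt x′ → ζ n i j x ≡ ζ n i j′ x′ → j ≡ j′ × x ≡ x′)
-- The hypothesis n > 1 only excludes n = 0; the argument also covers n = 1.
lemma5 zero    ()
lemma5 (suc m) _  i =
    ( embed , embed-InSTi , embed-surjective , (λ σ τ _ _ → embed-injective σ τ)
    , λ σ τ dσ dτ → STAdj⇒Arc-embed σ τ dσ
                  , λ { (inj₁ arc) → Arc-embed⇒STAdj σ τ dσ dτ arc
                      ; (inj₂ arc) → STAdj-sym τ σ (Arc-embed⇒STAdj τ σ dτ dσ arc) } )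
  , Arc-oriented
  , (λ v → Neighbour⇒ζ-Image v , ζ-Image⇒Neighbour v)
  , ζ-disjoint
  where open StarCopy i
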